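{- Let $n$ be a positive integer. For $t\in\mathbb{N}=\{1,2,3,\dots\}$ let the $t$-th Chebyshev Segment of $n$ be $$S_t(n)=\{p \text{ prime} : (n+1)/t < p < 2n/(2t-1)\},$$ regarded as a Segment of type ${}_p((n+1)/t;\,2n/(2t-1))$ with lower boundary $(n+1)/t$ and upper boundary $2n/(2t-1)$. Then the number of Segments of this type (i.e. the number of indices $t\in\mathbb{N}$ for which the lower boundary $(n+1)/t$ is strictly less than the upper boundary $2n/(2t-1)$) is less than $(n+1)/2$.
   Context: This concerns the factorization of the $n$-th Catalan number $\mathrm{Cat}(n)=\frac{(2n)!}{n!\,(n+1)!}$. For real numbers $a<b$, ${}_p(a;b)$ denotes the set of primes $p$ with $a<p<b$ (a "prime interval"). A Segment whose lower boundary is at least its upper boundary is called collapsed or inverted and is not counted. -}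

module Defs where

open import Data.Nat using (ℕ; suc; _*_)
open import Data.Integer using (+_)
open import Data.Rational using (ℚ; _/_; _<_)
open import Data.Rational.Properties using (_<?_)
open import Data.List using (List; length; filter; upTo)

-- Indices t ∈ ℕ = {1,2,3,...} are represented as t = suc k with k : ℕ.

lowerB : ℕ → ℕ → ℚ
lowerB n k = (+ suc n) / suc k

-- upper boundary 2n/(2t-1), where 2t-1 = 2k+1 = suc (2 * k)
upperB : ℕ → ℕ → ℚ
upperB n k = (+ (2 * n)) / suc (2 * k)

countSegments : ℕ → ℕ → ℕ
countSegments n M = length (filter (λ k → lowerB n k <? upperB n k) (upTo M))

{-# OPTIONS --safe #-}
-- Cross-multiplying, (n+1)/t < 2n/(2t-1) becomes (n+1)(2t-1) < 2nt, i.e. 2t < n+1.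
-- So only indices t ≤ ⌊n/2⌋ give a Segment, and ⌊n/2⌋ < (n+1)/2.
module Submission where

open import Defs
open import Data.Nat using (ℕ; suc; _≤_)
open import Data.Integer using (+_)
open import Data.Rational using (_/_; _<_)

import Data.Nat as ℕ
open import Data.Nat using (zero; _+_; _*_; z≤n)
open import Data.Nat.Properties
  using (≤-trans; ≤-<-trans; *-monoˡ-≤; +-comm; +-identityʳ; *-comm; *-identityʳ; +-cancelˡ-<)
open import Data.Nat.DivMod using (m*n/n≡m; /-monoˡ-≤; m/n*n≤m)
import Data.Integer as ℤ
import Data.Integer.Properties as ℤ
import Data.Rational.Properties as ℚ
import Data.Rational.Unnormalised as ℚᵘ
import Data.Rational.Unnormalised.Properties as ℚᵘ
open import Data.List using (length; filter; upTo; [_])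
open import Data.List.Properties using (upTo-∷ʳ; filter-++; length-++; length-filter; length-upTo)
open import Relation.Binary.PropositionalEquality using (_≡_; refl; sym; trans; cong; subst; subst₂)
open import Relation.Unary using (Pred; Decidable)
open import Relation.Nullary using (yes; no)
open import Function using (_∘_)
open import Data.Nat.Solver using (module +-*-Solver)
open +-*-Solver using (solve; _:+_; _:*_; _:=_; con)

m/n<o/p⇒m*p<o*n : ∀ m n o p → (+ m) / suc n < (+ o) / suc p → m * suc p ℕ.< o * suc n
m/n<o/p⇒m*p<o*n m n o p m/n<o/p =
  ℤ.drop‿+<+ (subst₂ ℤ._<_ (sym (ℤ.pos-* m (suc p))) (sym (ℤ.pos-* o (suc n)))
    (ℚᵘ.drop-*<* (ℚᵘ.<-respʳ-≃ (ℚ.toℚᵘ-fromℚᵘ v) (ℚᵘ.<-respˡ-≃ (ℚ.toℚᵘ-fromℚᵘ u)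
      (ℚ.toℚᵘ-mono-< m/n<o/p)))))
  where
  -- (+ m) / suc n unfolds to ℚ.fromℚᵘ u.
  u v : ℚᵘ.ℚᵘ
  u = ℚᵘ.mkℚᵘ (+ m) n
  v = ℚᵘ.mkℚᵘ (+ o) p

m*p<o*n⇒m/n<o/p : ∀ m n o p → m * suc p ℕ.< o * suc n → (+ m) / suc n < (+ o) / suc p
m*p<o*n⇒m/n<o/p m n o p m*p<o*n =
  ℚ.toℚᵘ-cancel-< (ℚᵘ.<-respʳ-≃ (ℚᵘ.≃-sym (ℚ.toℚᵘ-fromℚᵘ v))
    (ℚᵘ.<-respˡ-≃ (ℚᵘ.≃-sym (ℚ.toℚᵘ-fromℚᵘ u)) (ℚᵘ.*<*
      (subst₂ ℤ._<_ (ℤ.pos-* m (suc p)) (ℤ.pos-* o (suc n)) (ℤ.+<+ m*p<o*n)))))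
  where
  u v : ℚᵘ.ℚᵘ
  u = ℚᵘ.mkℚᵘ (+ m) n
  v = ℚᵘ.mkℚᵘ (+ o) p

length-filter-upTo-suc : ∀ {p} {P : Pred ℕ p} (P? : Decidable P) M →
                         length (filter P? (upTo (suc M))) ≡
                         length (filter P? (upTo M)) + length (filter P? [ M ])
length-filter-upTo-suc P? M =
  trans (cong (λ xs → length (filter P? xs)) (sym (upTo-∷ʳ M)))
    (trans (cong length (filter-++ P? (upTo M) [ M ])) (length-++ (filter P? (upTo M))))

length-filter-upTo≤ : ∀ {p} {P : Pred ℕ p} (P? : Decidable P) {b} →
                      (∀ {k} → P k → k ℕ.< b) → ∀ M → length (filter P? (upTo M)) ≤ b
length-filter-upTo≤ P? below zero = z≤n
length-filter-upTo≤ P? {b} below (suc M)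
  rewrite length-filter-upTo-suc P? M
  with P? M
... | yes PM = subst (_≤ b) (+-comm 1 c) (≤-<-trans c≤M (below PM))
  where
  c : ℕ
  c = length (filter P? (upTo M))
  c≤M : c ≤ M
  c≤M = subst (c ≤_) (length-upTo M) (length-filter P? (upTo M))
... | no _ = subst (_≤ b) (sym (+-identityʳ _)) (length-filter-upTo≤ P? below M)

lowerB<upperB⇒2k+1<n : ∀ n k → lowerB n k < upperB n k → suc (2 * k) ℕ.< n
lowerB<upperB⇒2k+1<n n k lower<upper =
  +-cancelˡ-< (2 * n * k + n) (suc (2 * k)) n
    (subst₂ ℕ._<_ lhs rhs (m/n<o/p⇒m*p<o*n (suc n) k (2 * n) (2 * k) lower<upper))
  where
  lhs : suc n * suc (2 * k) ≡ 2 * n * k + n + suc (2 * k)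
  lhs = solve 2 (λ n k → (con 1 :+ n) :* (con 1 :+ con 2 :* k)
                         := con 2 :* n :* k :+ n :+ (con 1 :+ con 2 :* k)) refl n k
  rhs : 2 * n * suc k ≡ 2 * n * k + n + n
  rhs = solve 2 (λ n k → con 2 :* n :* (con 1 :+ k) := con 2 :* n :* k :+ n :+ n) refl n k

2k+1<n⇒k<n/2 : ∀ {n k} → suc (2 * k) ℕ.< n → k ℕ.< n ℕ./ 2
2k+1<n⇒k<n/2 {n} {k} 2k+1<n =
  subst (_≤ n ℕ./ 2) (m*n/n≡m (suc k) 2)
    (/-monoˡ-≤ 2 (subst (λ j → suc (suc j) ≤ n) (*-comm 2 k) 2k+1<n))

countSegments≤n/2 : ∀ n M → countSegments n M ≤ n ℕ./ 2
countSegments≤n/2 n = length-filter-upTo≤ (λ k → lowerB n k ℚ.<? upperB n k)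
                        (λ {k} → 2k+1<n⇒k<n/2 ∘ lowerB<upperB⇒2k+1<n n k)

proposition2p1 : (n : ℕ) → 1 ≤ n → (M : ℕ) →
    ((+ countSegments n M) / 1) < ((+ suc n) / 2)
proposition2p1 n _ M = m*p<o*n⇒m/n<o/p (countSegments n M) 0 (suc n) 1 twice-count<n+1
  where
  twice-count<n+1 : countSegments n M * 2 ℕ.< suc n * 1
  twice-count<n+1 = subst (countSegments n M * 2 ℕ.<_) (sym (*-identityʳ (suc n)))
    (ℕ.s≤s (≤-trans (*-monoˡ-≤ 2 (countSegments≤n/2 n M)) (m/n*n≤m n 2)))
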